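{- Let $n,m\geq 1$ and let $\mathscr{A}_{n,m}$ be the set of all $n\times m$ binary arrays. For $A=(a_{i,j})\in\mathscr{A}_{n,m}$, let $A^*=(a^*_{i,j})$ be the $n\times m$ array in which $a^*_{i,j}$ is the minimum of $a_{i,j}$ and of the entries $a_{i\pm1,j}$, $a_{i,j\pm1}$ that exist (i.e. the minimum over the entry and its horizontal and vertical neighbours in the array), and let $\mathscr{A}^*_{n,m}=\{A^*\mid A\in\mathscr{A}_{n,m}\}$. Then $n_\mathscr{D}(P_n\square P_m)=|\mathscr{A}^*_{n,m}|$.
   Context: $P_n$ is the path of order $n$ and $G\square H$ denotes the Cartesian product of graphs $G$ and $H$. For a graph $G$ and $v\in V(G)$, $N[v]$ is the closed neighbourhood of $v$ (the neighbours of $v$ together with $v$), and for $S\subseteq V(G)$, $N[S]=\bigcup_{v\in S}N[v]$. A set $S\subseteq V(G)$ is digitally convex if for every $v\in V(G)$, $N[v]\subseteq N[S]$ implies $v\in S$ (in particular $\emptyset$ and $V(G)$ are digitally convex). $n_\mathscr{D}(G)$ denotes the number of digitally convex subsets of $V(G)$. Note that $\mathscr{A}^*_{n,m}$ is a set, so distinct arrays $A$ with the same $A^*$ contribute only once. -}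

module Defs where

open import Data.Nat using (ℕ; zero; suc)
open import Data.Nat.Properties using () renaming (_≟_ to _≟ℕ_)
open import Data.Bool using (Bool; true; false; _∧_)
open import Data.Bool.Properties using () renaming (_≟_ to _≟B_)
open import Data.Fin using (Fin; toℕ)
open import Data.Fin.Properties using (all?; any?)
open import Data.Vec using (Vec; []; _∷_; lookup)
open import Data.Vec.Properties using (≡-dec)
open import Data.List using (List; []; _∷_; map; concatMap; filter; length; deduplicate)
open import Data.Product using (_×_; _,_; ∃; Σ)
open import Data.Sum using (_⊎_; inj₁; inj₂)
open import Relation.Nullary using (Dec; yes; no; ¬_)
open import Relation.Nullary.Decidable using (_⊎-dec_; _×-dec_; _→-dec_)
open import Relation.Binary.PropositionalEquality using (_≡_)

PathAdj : ∀ {n} → Fin n → Fin n → Set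
PathAdj i i' = (toℕ i' ≡ suc (toℕ i)) ⊎ (toℕ i ≡ suc (toℕ i'))

GridAdj : ∀ {n m} → Fin n × Fin m → Fin n × Fin m → Set
GridAdj (i , j) (i' , j') = (i ≡ i' × PathAdj j j') ⊎ (PathAdj i i' × j ≡ j')

Vertex : ℕ → ℕ → Set
Vertex n m = Fin n × Fin m

-- subsets of V(P_n □ P_m) (equivalently n×m binary arrays)
Array : ℕ → ℕ → Set
Array n m = Vec (Vec Bool m) n

_∈S_ : ∀ {n m} → Vertex n m → Array n m → Set
(i , j) ∈S S = lookup (lookup S i) j ≡ true

_∈N[_] : ∀ {n m} → Vertex n m → Vertex n m → Set
u ∈N[ v ] = (u ≡ v) ⊎ GridAdj v u

_∈N[S_] : ∀ {n m} → Vertex n m → Array n m → Set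
u ∈N[S S ] = ∃ λ s → (s ∈S S) × (u ∈N[ s ])

DigitallyConvex : ∀ {n m} → Array n m → Set
DigitallyConvex {n} {m} S =
  ∀ (v : Vertex n m) → (∀ (u : Vertex n m) → u ∈N[ v ] → u ∈N[S S ]) → v ∈S S

private
  fin≟ : ∀ {k} (a b : Fin k) → Dec (a ≡ b)
  fin≟ = Data.Fin._≟_
    where import Data.Fin

  pathAdj? : ∀ {k} (a b : Fin k) → Dec (PathAdj a b)
  pathAdj? a b = (toℕ b ≟ℕ suc (toℕ a)) ⊎-dec (toℕ a ≟ℕ suc (toℕ b))

  vtx≟ : ∀ {n m} (a b : Vertex n m) → Dec (a ≡ b)
  vtx≟ (i , j) (i' , j') with fin≟ i i' | fin≟ j j'
  ... | yes Relation.Binary.PropositionalEquality.refl | yes Relation.Binary.PropositionalEquality.refl = yes Relation.Binary.PropositionalEquality.refl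
  ... | no ¬p | _ = no λ { Relation.Binary.PropositionalEquality.refl → ¬p Relation.Binary.PropositionalEquality.refl }
  ... | yes _ | no ¬q = no λ { Relation.Binary.PropositionalEquality.refl → ¬q Relation.Binary.PropositionalEquality.refl }

  gridAdj? : ∀ {n m} (a b : Vertex n m) → Dec (GridAdj a b)
  gridAdj? (i , j) (i' , j') =
    (fin≟ i i' ×-dec pathAdj? j j') ⊎-dec (pathAdj? i i' ×-dec fin≟ j j')

  allV? : ∀ {n m} {P : Vertex n m → Set} → (∀ v → Dec (P v)) → Dec (∀ v → P v)
  allV? {P = P} P? with all? (λ i → all? (λ j → P? (i , j)))
  ... | yes p = yes λ { (i , j) → p i j }
  ... | no ¬p = no λ h → ¬p λ i j → h (i , j)

  anyV? : ∀ {n m} {P : Vertex n m → Set} → (∀ v → Dec (P v)) → Dec (∃ P)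
  anyV? {P = P} P? with any? (λ i → any? (λ j → P? (i , j)))
  ... | yes (i , j , p) = yes ((i , j) , p)
  ... | no ¬p = no λ { ((i , j) , p) → ¬p (i , j , p) }

  ∈S? : ∀ {n m} (v : Vertex n m) (S : Array n m) → Dec (v ∈S S)
  ∈S? (i , j) S = lookup (lookup S i) j ≟B true

  ∈N? : ∀ {n m} (u v : Vertex n m) → Dec (u ∈N[ v ])
  ∈N? u v = vtx≟ u v ⊎-dec gridAdj? v u

  ∈NS? : ∀ {n m} (u : Vertex n m) (S : Array n m) → Dec (u ∈N[S S ])
  ∈NS? u S = anyV? (λ s → ∈S? s S ×-dec ∈N? u s)

digitallyConvex? : ∀ {n m} (S : Array n m) → Dec (DigitallyConvex S)
digitallyConvex? S =
  allV? (λ v → allV? (λ u → ∈N? u v →-dec ∈NS? u S) →-dec ∈S? v S)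

allVecs : ∀ {A : Set} → List A → (k : ℕ) → List (Vec A k)
allVecs xs zero    = [] ∷ []
allVecs xs (suc k) = concatMap (λ v → map (λ x → x ∷ v) xs) (allVecs xs k)

allArrays : (n m : ℕ) → List (Array n m)
allArrays n m = allVecs (allVecs (true ∷ false ∷ []) m) n

nD-grid : ℕ → ℕ → ℕ
nD-grid n m = length (filter digitallyConvex? (allArrays n m))

-- The array A*: entrywise minimum over the entry and its existing
-- horizontal/vertical neighbours (non-existent entries are ignored,
-- implemented by treating them as 1 = true, the neutral element of min).

vecAt : ∀ {k} → Vec Bool k → ℕ → Bool
vecAt []       _       = true
vecAt (x ∷ xs) zero    = x
vecAt (x ∷ xs) (suc i) = vecAt xs i

entryAt : ∀ {n m} → Array n m → ℕ → ℕ → Bool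
entryAt []       _       j = true
entryAt (r ∷ rs) zero    j = vecAt r j
entryAt (r ∷ rs) (suc i) j = entryAt rs i j

entryUp : ∀ {n m} → Array n m → ℕ → ℕ → Bool
entryUp A zero    j = true
entryUp A (suc i) j = entryAt A i j

entryLeft : ∀ {n m} → Array n m → ℕ → ℕ → Bool
entryLeft A i zero    = true
entryLeft A i (suc j) = entryAt A i j

starEntry : ∀ {n m} → Array n m → ℕ → ℕ → Bool
starEntry A i j =
  entryAt A i j ∧ entryUp A i j ∧ entryAt A (suc i) j
    ∧ entryLeft A i j ∧ entryAt A i (suc j)

star : ∀ {n m} → Array n m → Array n m
star {n} {m} A =
  Data.Vec.tabulate λ (i : Fin n) → Data.Vec.tabulate λ (j : Fin m) →
    starEntry A (toℕ i) (toℕ j)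
  where import Data.Vec

card-A* : ℕ → ℕ → ℕ
card-A* n m = length (deduplicate (≡-dec (≡-dec _≟B_)) (map star (allArrays n m)))

-- Write N[v] ⊆ A for "every vertex of the closed neighbourhood of v is a
-- 1-entry of A".  The array A* is the morphological interior of A:
--     v ∈ A*  ⇔  N[v] ⊆ A                                  (star-spec).
-- From this the digitally convex sets are exactly the arrays A*:
--   * A* is digitally convex: if N[v] ⊆ N[A*], every u ∈ N[v] lies in
--     N[s] ⊆ A for some s ∈ A*, hence N[v] ⊆ A, i.e. v ∈ A*;
--   * a digitally convex S equals (N[S])*, since for every v
--     N[v] ⊆ N[S] ⇔ v ∈ S (⇒ is convexity, ⇐ holds for all S).
-- Hence the list of digitally convex arrays (a filter of the enumeration
-- of all arrays) and the deduplicated list of all A* have the same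
-- elements; both lists are duplicate-free, so they have the same length.

module Submission where

open import Defs
open import Data.Nat using (ℕ; _≤_; zero; suc) renaming (_≟_ to _≟ℕ_)
open import Data.Bool using (Bool; true; false; _∧_)
open import Data.Bool.Properties using () renaming (_≟_ to _≟B_)
open import Data.Fin using (Fin; toℕ) renaming (zero to fzero; suc to fsuc; _≟_ to _≟F_)
open import Data.Fin.Properties using (any?; toℕ-injective)
open import Data.Vec using (Vec; []; _∷_; lookup; tabulate)
open import Data.Vec.Properties using (≡-dec; lookup∘tabulate; tabulate∘lookup; tabulate-cong; ∷-injective)
open import Data.List using (List; []; _∷_; map; concatMap; filter; length; deduplicate; cartesianProductWith; _++_)
open import Data.List.Membership.Propositional using (_∈_)
open import Data.List.Membership.Propositional.Properties
  using (∈-map⁺; ∈-map⁻; ∈-filter⁺; ∈-filter⁻; ∈-deduplicate⁺; ∈-deduplicate⁻; ∈-cartesianProductWith⁺)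
open import Data.List.Membership.Propositional.Properties.WithK using (unique∧set⇒bag)
open import Data.List.Relation.Unary.Any using (here; there)
open import Data.List.Relation.Unary.All using () renaming ([] to []ᵃ; _∷_ to _∷ᵃ_)
open import Data.List.Relation.Unary.AllPairs using () renaming ([] to []ᵖ; _∷_ to _∷ᵖ_)
open import Data.List.Relation.Unary.Unique.Propositional using (Unique)
open import Data.List.Relation.Unary.Unique.Propositional.Properties using (filter⁺; cartesianProductWith⁺)
open import Data.List.Relation.Unary.Unique.DecPropositional.Properties using (deduplicate-!)
open import Data.List.Relation.Binary.BagAndSetEquality using (∼bag⇒↭)
open import Data.List.Relation.Binary.Permutation.Propositional.Properties using (↭-length)
open import Data.Product using (_×_; _,_; ∃; proj₂; swap)
open import Data.Product.Properties using () renaming (≡-dec to ×-≡-dec)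
open import Data.Sum using (inj₁; inj₂)
open import Function.Bundles using (_⇔_; mk⇔; Equivalence)
open import Relation.Nullary using (Dec; yes; no; does)
open import Relation.Nullary.Decidable using (_⊎-dec_; _×-dec_; map′; dec-true)
open import Relation.Binary.PropositionalEquality using (_≡_; refl; sym; trans; cong)

∧-intro : ∀ {x y} → x ≡ true → y ≡ true → x ∧ y ≡ true
∧-intro refl refl = refl

bool-ext : ∀ {b c : Bool} → (b ≡ true → c ≡ true) → (c ≡ true → b ≡ true) → b ≡ c
bool-ext {true}  {true}  _ _ = refl
bool-ext {true}  {false} f _ = sym (f refl)
bool-ext {false} {true}  _ g = g refl
bool-ext {false} {false} _ _ = refl

vecAt-lookup : ∀ {k} (r : Vec Bool k) (j : Fin k) → vecAt r (toℕ j) ≡ lookup r j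
vecAt-lookup (x ∷ r) fzero    = refl
vecAt-lookup (x ∷ r) (fsuc j) = vecAt-lookup r j

entryAt-lookup : ∀ {n m} (A : Array n m) (i : Fin n) (j : Fin m) →
  entryAt A (toℕ i) (toℕ j) ≡ lookup (lookup A i) j
entryAt-lookup (r ∷ A) fzero    j = vecAt-lookup r j
entryAt-lookup (r ∷ A) (fsuc i) j = entryAt-lookup A i j

-- an out-of-range position reads as true, so 'vecAt r b' is true as soon
-- as every entry of r at position b (there is at most one) is true;
-- likewise for 'entryAt', whose converse is 'entryAt-sound'
vecAt-complete : ∀ {k} (r : Vec Bool k) b →
  (∀ {j} → toℕ j ≡ b → lookup r j ≡ true) → vecAt r b ≡ true
vecAt-complete []      b       _ = refl
vecAt-complete (x ∷ r) zero    h = h {fzero} refl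
vecAt-complete (x ∷ r) (suc b) h = vecAt-complete r b (λ e → h (cong suc e))

entryAt-complete : ∀ {n m} (A : Array n m) a b →
  (∀ {i j} → toℕ i ≡ a → toℕ j ≡ b → (i , j) ∈S A) → entryAt A a b ≡ true
entryAt-complete []      a       b _ = refl
entryAt-complete (r ∷ A) zero    b h = vecAt-complete r b (h {fzero} refl)
entryAt-complete (r ∷ A) (suc a) b h = entryAt-complete A a b (λ ei → h (cong suc ei))

entryAt-sound : ∀ {n m} (A : Array n m) {a b i j} →
  entryAt A a b ≡ true → toℕ i ≡ a → toℕ j ≡ b → (i , j) ∈S A
entryAt-sound A {i = i} {j} e refl refl = trans (sym (entryAt-lookup A i j)) e

module _ {n m} (A : Array n m) where

  up-sound : ∀ {a b i j} → entryUp A a b ≡ true → a ≡ suc (toℕ i) → toℕ j ≡ b → (i , j) ∈S A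
  up-sound e refl ej = entryAt-sound A e refl ej

  up-complete : ∀ a b →
    (∀ {i j} → a ≡ suc (toℕ i) → toℕ j ≡ b → (i , j) ∈S A) → entryUp A a b ≡ true
  up-complete zero    b _ = refl
  up-complete (suc a) b h = entryAt-complete A a b (λ ei ej → h (cong suc (sym ei)) ej)

  left-sound : ∀ {a b i j} → entryLeft A a b ≡ true → toℕ i ≡ a → b ≡ suc (toℕ j) → (i , j) ∈S A
  left-sound e ei refl = entryAt-sound A e ei refl

  left-complete : ∀ a b →
    (∀ {i j} → toℕ i ≡ a → b ≡ suc (toℕ j) → (i , j) ∈S A) → entryLeft A a b ≡ true
  left-complete a zero    _ = refl
  left-complete a (suc b) h = entryAt-complete A a b (λ ei ej → h ei (cong suc (sym ej)))

vec-ext : ∀ {A : Set} {k} {xs ys : Vec A k} → (∀ i → lookup xs i ≡ lookup ys i) → xs ≡ ys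
vec-ext {xs = xs} {ys} h = trans (sym (tabulate∘lookup xs)) (trans (tabulate-cong h) (tabulate∘lookup ys))

array-ext : ∀ {n m} {X Y : Array n m} →
  (∀ i j → lookup (lookup X i) j ≡ lookup (lookup Y i) j) → X ≡ Y
array-ext h = vec-ext (λ i → vec-ext (h i))

tabulate²-lookup : ∀ {n m} (f : Fin n → Fin m → Bool) i j →
  lookup (lookup (tabulate λ i → tabulate (f i)) i) j ≡ f i j
tabulate²-lookup f i j = trans (cong (λ r → lookup r j) (lookup∘tabulate _ i)) (lookup∘tabulate _ j)

N[_]⊆_ : ∀ {n m} → Vertex n m → Array n m → Set
N[ v ]⊆ A = ∀ u → u ∈N[ v ] → u ∈S A

StarConditions : ∀ {n m} → Array n m → ℕ → ℕ → Set
StarConditions A a b =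
  entryAt A a b ≡ true × entryUp A a b ≡ true × entryAt A (suc a) b ≡ true ×
  entryLeft A a b ≡ true × entryAt A a (suc b) ≡ true

starEntry⇒conditions : ∀ {n m} (A : Array n m) a b → starEntry A a b ≡ true → StarConditions A a b
starEntry⇒conditions A a b e
  with entryAt A a b | entryUp A a b | entryAt A (suc a) b | entryLeft A a b | entryAt A a (suc b)
... | true | true | true | true | true = refl , refl , refl , refl , refl

conditions⇒starEntry : ∀ {n m} (A : Array n m) a b → StarConditions A a b → starEntry A a b ≡ true
conditions⇒starEntry A a b (e₁ , e₂ , e₃ , e₄ , e₅) = ∧-intro e₁ (∧-intro e₂ (∧-intro e₃ (∧-intro e₄ e₅)))

module _ {n m} (A : Array n m) (i : Fin n) (j : Fin m) where

  conditions⇒N⊆ : StarConditions A (toℕ i) (toℕ j) → N[ (i , j) ]⊆ A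
  conditions⇒N⊆ (eHere , _ , _ , _ , _) _ (inj₁ refl)                   = entryAt-sound A eHere refl refl
  conditions⇒N⊆ (_ , _ , _ , _ , eRight) _ (inj₂ (inj₁ (refl , inj₁ ej))) = entryAt-sound A eRight refl ej
  conditions⇒N⊆ (_ , _ , _ , eLeft , _)  _ (inj₂ (inj₁ (refl , inj₂ ej))) = left-sound A eLeft refl ej
  conditions⇒N⊆ (_ , _ , eDown , _ , _)  _ (inj₂ (inj₂ (inj₁ ei , refl))) = entryAt-sound A eDown ei refl
  conditions⇒N⊆ (_ , eUp , _ , _ , _)    _ (inj₂ (inj₂ (inj₂ ei , refl))) = up-sound A eUp ei refl

  N⊆⇒conditions : N[ (i , j) ]⊆ A → StarConditions A (toℕ i) (toℕ j)
  N⊆⇒conditions h =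
      trans (entryAt-lookup A i j) (h (i , j) (inj₁ refl))
    , up-complete A (toℕ i) (toℕ j) (λ ei ej → h _ (inj₂ (inj₂ (inj₂ ei , sameCol ej))))
    , entryAt-complete A (suc (toℕ i)) (toℕ j) (λ ei ej → h _ (inj₂ (inj₂ (inj₁ ei , sameCol ej))))
    , left-complete A (toℕ i) (toℕ j) (λ ei ej → h _ (inj₂ (inj₁ (sameRow ei , inj₂ ej))))
    , entryAt-complete A (toℕ i) (suc (toℕ j)) (λ ei ej → h _ (inj₂ (inj₁ (sameRow ei , inj₁ ej))))
    where
    sameRow : ∀ {i'} → toℕ i' ≡ toℕ i → i ≡ i'
    sameRow e = toℕ-injective (sym e)
    sameCol : ∀ {j'} → toℕ j' ≡ toℕ j → j ≡ j'
    sameCol e = toℕ-injective (sym e)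

star-spec : ∀ {n m} (A : Array n m) (v : Vertex n m) → v ∈S star A ⇔ N[ v ]⊆ A
star-spec A (i , j) = mk⇔
  (λ e → conditions⇒N⊆ A i j (starEntry⇒conditions A _ _ (trans (sym (tabulate²-lookup _ i j)) e)))
  (λ h → trans (tabulate²-lookup _ i j) (conditions⇒starEntry A _ _ (N⊆⇒conditions A i j h)))

∈NS? : ∀ {n m} (u : Vertex n m) (S : Array n m) → Dec (u ∈N[S S ])
∈NS? u S = map′ (λ (i , j , p) → (i , j) , p) (λ ((i , j) , p) → i , j , p)
  (any? λ i → any? λ j → ∈S? (i , j) ×-dec ∈N? u (i , j))
  where
  ∈S? : ∀ v → Dec (v ∈S S)
  ∈S? (i , j) = lookup (lookup S i) j ≟B true
  path? : ∀ {k} (a b : Fin k) → Dec (PathAdj a b)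
  path? a b = (toℕ b ≟ℕ suc (toℕ a)) ⊎-dec (toℕ a ≟ℕ suc (toℕ b))
  ∈N? : ∀ u v → Dec (u ∈N[ v ])
  ∈N? (i' , j') (i , j) = ×-≡-dec _≟F_ _≟F_ (i' , j') (i , j)
    ⊎-dec ((i ≟F i' ×-dec path? j j') ⊎-dec (path? i i' ×-dec j ≟F j'))

closure : ∀ {n m} → Array n m → Array n m
closure S = tabulate λ i → tabulate λ j → does (∈NS? (i , j) S)

closure-spec : ∀ {n m} (S : Array n m) (u : Vertex n m) → u ∈S closure S ⇔ u ∈N[S S ]
closure-spec S (i , j) = mk⇔
  (λ e → does-sound (∈NS? (i , j) S) (trans (sym (tabulate²-lookup _ i j)) e))
  (λ p → trans (tabulate²-lookup _ i j) (dec-true (∈NS? (i , j) S) p))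
  where
  does-sound : ∀ {P : Set} (d : Dec P) → does d ≡ true → P
  does-sound (yes p) _ = p
  does-sound (no _)  ()

-- an interior is convex: N[v] ⊆ N[A*] forces N[v] ⊆ A
star-convex : ∀ {n m} (A : Array n m) → DigitallyConvex (star A)
star-convex A v N[v]⊆N[A*] = Equivalence.from (star-spec A v) λ u u∈N[v] →
  let (s , s∈A* , u∈N[s]) = N[v]⊆N[A*] u u∈N[v]
  in Equivalence.to (star-spec A s) s∈A* u u∈N[s]

-- v ∈ (N[S])* ⇔ N[v] ⊆ N[S] ⇔ v ∈ S, the last step by convexity (⇒)
-- and because v ∈ N[v] (⇐)
convex⇒star-closure : ∀ {n m} (S : Array n m) → DigitallyConvex S → star (closure S) ≡ S
convex⇒star-closure S convex = array-ext λ i j → bool-ext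
  (λ e → convex (i , j) λ u u∈N[v] →
     Equivalence.to (closure-spec S u) (Equivalence.to (star-spec (closure S) (i , j)) e u u∈N[v]))
  (λ e → Equivalence.from (star-spec (closure S) (i , j)) λ u u∈N[v] →
     Equivalence.from (closure-spec S u) ((i , j) , e , u∈N[v]))

convex⇔star-image : ∀ {n m} (S : Array n m) → DigitallyConvex S ⇔ ∃ λ A → star A ≡ S
convex⇔star-image S = mk⇔
  (λ convex → closure S , convex⇒star-closure S convex)
  (λ { (A , refl) → star-convex A })

prepend : ∀ {A : Set} {k} → Vec A k → A → Vec A (suc k)
prepend v x = x ∷ v

allVecs-suc : ∀ {A : Set} (xs : List A) k →
  allVecs xs (suc k) ≡ cartesianProductWith prepend (allVecs xs k) xs
allVecs-suc xs k = asProduct (allVecs xs k)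
  where
  asProduct : ∀ ys → concatMap (λ v → map (prepend v) xs) ys ≡ cartesianProductWith prepend ys xs
  asProduct []       = refl
  asProduct (y ∷ ys) = cong (map (prepend y) xs ++_) (asProduct ys)

allVecs-complete : ∀ {A : Set} (xs : List A) → (∀ x → x ∈ xs) →
  ∀ k (v : Vec A k) → v ∈ allVecs xs k
allVecs-complete xs all zero    []      = here refl
allVecs-complete xs all (suc k) (x ∷ v) rewrite allVecs-suc xs k =
  ∈-cartesianProductWith⁺ prepend (allVecs-complete xs all k v) (all x)

allVecs-unique : ∀ {A : Set} (xs : List A) → Unique xs → ∀ k → Unique (allVecs xs k)
allVecs-unique xs unique zero    = []ᵃ ∷ᵖ []ᵖ
allVecs-unique xs unique (suc k) rewrite allVecs-suc xs k =
  cartesianProductWith⁺ prepend (λ eq → swap (∷-injective eq)) (allVecs-unique xs unique k) unique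

bools-complete : ∀ b → b ∈ (true ∷ false ∷ [])
bools-complete true  = here refl
bools-complete false = there (here refl)

bools-unique : Unique (true ∷ false ∷ [])
bools-unique = ((λ ()) ∷ᵃ []ᵃ) ∷ᵖ ([]ᵃ ∷ᵖ []ᵖ)

arrays-complete : ∀ n m (A : Array n m) → A ∈ allArrays n m
arrays-complete n m = allVecs-complete _ (allVecs-complete _ bools-complete m) n

arrays-unique : ∀ n m → Unique (allArrays n m)
arrays-unique n m = allVecs-unique _ (allVecs-unique _ bools-unique m) n

unique-same-members⇒length : ∀ {A : Set} {xs ys : List A} → Unique xs → Unique ys →
  (∀ {z} → z ∈ xs ⇔ z ∈ ys) → length xs ≡ length ys
unique-same-members⇒length uxs uys same = ↭-length (∼bag⇒↭ (unique∧set⇒bag uxs uys same))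

mainTheorem6 : (n m : ℕ) → 1 ≤ n → 1 ≤ m → nD-grid n m ≡ card-A* n m
mainTheorem6 n m _ _ = unique-same-members⇒length
  (filter⁺ digitallyConvex? (arrays-unique n m))
  (deduplicate-! arrayDec (map star arrays))
  (mk⇔ convex⇒image image⇒convex)
  where
  arrays : List (Array n m)
  arrays = allArrays n m
  arrayDec : (X Y : Array n m) → Dec (X ≡ Y)
  arrayDec = ≡-dec (≡-dec _≟B_)

  convex⇒image : ∀ {S} → S ∈ filter digitallyConvex? arrays →
                 S ∈ deduplicate arrayDec (map star arrays)
  convex⇒image {S} S∈
    with Equivalence.to (convex⇔star-image S) (proj₂ (∈-filter⁻ digitallyConvex? {xs = arrays} S∈))
  ... | A , refl = ∈-deduplicate⁺ arrayDec (∈-map⁺ star (arrays-complete n m A))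

  image⇒convex : ∀ {S} → S ∈ deduplicate arrayDec (map star arrays) →
                 S ∈ filter digitallyConvex? arrays
  image⇒convex {S} S∈ with ∈-map⁻ star (∈-deduplicate⁻ arrayDec (map star arrays) S∈)
  ... | A , _ , refl = ∈-filter⁺ digitallyConvex? (arrays-complete n m (star A))
                         (Equivalence.from (convex⇔star-image (star A)) (A , refl))
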